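{- Let $I=(G=(V,E),\Sigma,\chi,w)$ be an instance of Decoder Retrieval, let $\mathcal{D}\subseteq\Sigma^2$, and assume that for every one-sided letter pair $\{a,b\}$, $w[a,b]$ contains at least two $a$-runs or at least two $b$-runs. Then $\mathcal{D}$ is a solution for $I$ if and only if all of the following hold: (1) for each $a\in\Sigma$, $\mathcal{D}\cap\{aa\}$ is a solution for the Decoder Retrieval instance whose graph has vertex set $V_a$ and edge set $E(V_a)$ (the edges of $G$ with both endpoints in $V_a$), alphabet $\{a\}$, coloring $\chi|_{V_a}$ and word $w[a]$; (2) for each pair $\{a,b\}$ of distinct letters that is not one-sided, $\mathcal{D}\cap\{ab,ba\}$ is a solution for the instance whose graph has vertex set $V_a\cup V_b$ and edge set $E(V_a,V_b)$, alphabet $\{a,b\}$, coloring $\chi|_{V_a\cup V_b}$ and word $w[a,b]$; (3) for each $a\in\Sigma$, $\mathcal{D}\cap\{ab,ba\mid b\in P_a\}$ is a solution for the instance whose graph has vertex set $\bigcup_{c\in P_a\cup\{a\}}V_c$ and edge set $\bigcup_{b\in P_a}E(V_a,V_b)$, alphabet $P_a\cup\{a\}$, coloring $\chi$ restricted to $\bigcup_{c\in P_a\cup\{a\}}V_c$, and word $w[P_a\cup\{a\}]$.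
   Context: An instance of Decoder Retrieval consists of a finite simple graph $G=(V,E)$, a finite alphabet $\Sigma$, a coloring $\chi\colon V\to\Sigma$ and a word $w\in\Sigma^{|V|}$, where for every $a\in\Sigma$ the set $V_a=\chi^{ -1}(a)$ is non-empty and $w$ contains $a$ exactly $|V_a|$ times. A set $\mathcal{D}\subseteq\Sigma^2$ is a solution if there is a graph isomorphism $f$ from $G$ to the letter graph $G(\mathcal{D},w)$ with $w_{f(v)}=\chi(v)$ for all $v$, where $G(\mathcal{D},w)$ has vertex set $\{1,\dots,|w|\}$ and edges $\{i,j\}$ for $i<j$ with $w_iw_j\in\mathcal{D}$. $E(X,Y)$ denotes the set of edges with one endpoint in $X$ and one in $Y$; a pair $\{a,b\}$ of distinct letters is one-sided if $0<|E(V_a,V_b)|<|V_a|\cdot|V_b|$. For $\Sigma'\subseteq\Sigma$, $w[\Sigma']$ is the maximal subsequence of $w$ consisting of the letters in $\Sigma'$ (and $w[a,b]=w[\{a,b\}]$, $w[a]=w[\{a\}]$). A $c$-run of a word is a maximal non-empty factor consisting only of the letter $c$. For $a\in\Sigma$, $P_a$ is the set of letters $b\in\Sigma\setminus\{a\}$ such that $\{a,b\}$ is one-sided and $w[a,b]$ has at least two $a$-runs. -}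

module Defs where

open import Data.Bool.Base using (Bool; true; false; _∧_; _∨_; not; if_then_else_; T)
open import Data.Nat.Base using (ℕ; zero; suc; _*_; _<ᵇ_)
open import Data.Fin.Base using (Fin; toℕ)
open import Data.Fin.Properties using (_≟_)
open import Data.List.Base using (List; []; _∷_; length; lookup; filterᵇ; allFin; cartesianProduct)
open import Data.Product.Base using (Σ; ∃; _×_; _,_; proj₁; proj₂)
open import Function.Base using (_∘_)
open import Function.Bundles using (_↔_; Inverse)
open import Relation.Nullary.Decidable.Core using (does)
open import Relation.Binary.PropositionalEquality using (_≡_)

eqᵇ : ∀ {k} → Fin k → Fin k → Bool
eqᵇ a c = does (a ≟ c)

letterAdj : ∀ {k} (D : Fin k → Fin k → Bool) (w : List (Fin k)) →
            Fin (length w) → Fin (length w) → Bool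
letterAdj D w i j =
  ((toℕ i <ᵇ toℕ j) ∧ D (lookup w i) (lookup w j)) ∨
  ((toℕ j <ᵇ toℕ i) ∧ D (lookup w j) (lookup w i))

Solution : ∀ {k} {V : Set} (E : V → V → Bool) (χ : V → Fin k)
           (w : List (Fin k)) (D : Fin k → Fin k → Bool) → Set
Solution {V = V} E χ w D =
  Σ (V ↔ Fin (length w)) λ f →
    (∀ v → lookup w (Inverse.to f v) ≡ χ v) ×
    (∀ u v → E u v ≡ letterAdj D w (Inverse.to f u) (Inverse.to f v))

sizeV : ∀ {n k} (χ : Fin n → Fin k) (a : Fin k) → ℕ
sizeV {n} χ a = length (filterᵇ (λ v → eqᵇ (χ v) a) (allFin n))

countL : ∀ {k} (a : Fin k) (w : List (Fin k)) → ℕ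
countL a w = length (filterᵇ (λ c → eqᵇ c a) w)

IsInstance : ∀ {n k} (E : Fin n → Fin n → Bool) (χ : Fin n → Fin k)
             (w : List (Fin k)) → Set
IsInstance {n} {k} E χ w =
  (∀ u v → E u v ≡ E v u) ×
  (∀ v → E v v ≡ false) ×
  (length w ≡ n) ×
  (∀ (a : Fin k) → ∃ λ v → χ v ≡ a) ×
  (∀ (a : Fin k) → countL a w ≡ sizeV χ a)

-- |E(V_a,V_b)| for a ≠ b: number of ordered pairs (u,v) with u ∈ V_a,
-- v ∈ V_b, uv ∈ E (each such edge is counted exactly once when a ≠ b).
crossEdges : ∀ {n k} (E : Fin n → Fin n → Bool) (χ : Fin n → Fin k)
             (a b : Fin k) → ℕ
crossEdges {n} E χ a b =
  length (filterᵇ (λ p → eqᵇ (χ (proj₁ p)) a ∧ eqᵇ (χ (proj₂ p)) b ∧ E (proj₁ p) (proj₂ p))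
                  (cartesianProduct (allFin n) (allFin n)))

oneSided : ∀ {n k} (E : Fin n → Fin n → Bool) (χ : Fin n → Fin k)
           (a b : Fin k) → Bool
oneSided E χ a b =
  (0 <ᵇ crossEdges E χ a b) ∧ (crossEdges E χ a b <ᵇ sizeV χ a * sizeV χ b)

runsAux : ∀ {k} (c : Fin k) → Bool → List (Fin k) → ℕ
runsAux c p [] = 0
runsAux c p (x ∷ xs) =
  if eqᵇ x c then (if p then runsAux c true xs else suc (runsAux c true xs))
  else runsAux c false xs

runs : ∀ {k} (c : Fin k) → List (Fin k) → ℕ
runs c w = runsAux c false w

sub : ∀ {k} (S : Fin k → Bool) → List (Fin k) → List (Fin k)
sub S w = filterᵇ S w

pairL : ∀ {k} (a b : Fin k) → Fin k → Bool
pairL a b c = eqᵇ c a ∨ eqᵇ c b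

inP : ∀ {n k} (E : Fin n → Fin n → Bool) (χ : Fin n → Fin k)
      (w : List (Fin k)) (a b : Fin k) → Bool
inP E χ w a b =
  not (eqᵇ b a) ∧ oneSided E χ a b ∧ (1 <ᵇ runs a (sub (pairL a b) w))

SubSolution : ∀ {n k} (χ : Fin n → Fin k) (w : List (Fin k))
              (S : Fin k → Bool) (E' : Fin n → Fin n → Bool)
              (D' : Fin k → Fin k → Bool) → Set
SubSolution {n} χ w S E' D' =
  Solution {V = Σ (Fin n) (λ v → T (S (χ v)))}
           (λ u v → E' (proj₁ u) (proj₁ v)) (χ ∘ proj₁) (sub S w) D'

Cond1 : ∀ {n k} (E : Fin n → Fin n → Bool) (χ : Fin n → Fin k)
        (w : List (Fin k)) (D : Fin k → Fin k → Bool) → Set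
Cond1 {k = k} E χ w D = ∀ (a : Fin k) →
  SubSolution χ w (λ c → eqᵇ c a) E
              (λ c d → D c d ∧ eqᵇ c a ∧ eqᵇ d a)

Cond2 : ∀ {n k} (E : Fin n → Fin n → Bool) (χ : Fin n → Fin k)
        (w : List (Fin k)) (D : Fin k → Fin k → Bool) → Set
Cond2 {k = k} E χ w D = ∀ (a b : Fin k) → T (not (eqᵇ a b)) →
  T (not (oneSided E χ a b)) →
  SubSolution χ w (pairL a b)
    (λ u v → E u v ∧ ((eqᵇ (χ u) a ∧ eqᵇ (χ v) b) ∨ (eqᵇ (χ u) b ∧ eqᵇ (χ v) a)))
    (λ c d → D c d ∧ ((eqᵇ c a ∧ eqᵇ d b) ∨ (eqᵇ c b ∧ eqᵇ d a)))

Cond3 : ∀ {n k} (E : Fin n → Fin n → Bool) (χ : Fin n → Fin k)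
        (w : List (Fin k)) (D : Fin k → Fin k → Bool) → Set
Cond3 {k = k} E χ w D = ∀ (a : Fin k) →
  SubSolution χ w (λ c → eqᵇ c a ∨ inP E χ w a c)
    (λ u v → E u v ∧ ((eqᵇ (χ u) a ∧ inP E χ w a (χ v)) ∨ (inP E χ w a (χ u) ∧ eqᵇ (χ v) a)))
    (λ c d → D c d ∧ ((eqᵇ c a ∧ inP E χ w a d) ∨ (inP E χ w a c ∧ eqᵇ d a)))

-- Forward: an isomorphism G ≅ G(D,w) maps the vertices coloured in a letter set Σ′ onto the
-- positions of w[Σ′], in the same relative order, so restricting it (and the edges and the
-- decoder to the same letter pairs) gives an isomorphism onto the letter graph of w[Σ′].
-- Backward: condition (3) at c matches V_c with the c-positions of w, and gluing these matchings
-- gives a colour-preserving bijection f from V onto the positions of w. Adjacency is then checked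
-- colour pair by colour pair. Inside V_a, condition (1) shows that both graphs are complete or
-- both empty. If {a,b} is not one-sided then E(V_a,V_b) is complete or empty, and condition (2)
-- shows that so is the letter graph between a- and b-positions. If {a,b} is one-sided we may
-- assume b ∈ P_a, and condition (3) at a fixes the adjacency of f u to the b-positions. If
-- a ∉ P_b then w[a,b] has a single b-run, so an a-position lies on the same side of every
-- b-position and its adjacency does not depend on which b-position we take. If a ∈ P_b then
-- condition (3) at b puts u at a second a-position with equally many b-neighbours; since the
-- b-neighbourhoods of a-positions are nested, both positions have the same b-neighbours.

module Submission where

open import Defs
open import Data.Bool.Base using (Bool; true; false; T; _∧_; _∨_; not; if_then_else_)
open import Data.Bool.Properties
  using (T-∧; T-≡; T-irrelevant; ∧-assoc; ∧-comm; ∧-distribʳ-∨; ∧-identityʳ; ∨-comm; ∨-identityʳ)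
open import Data.Empty using (⊥-elim)
open import Data.Fin.Base using (Fin; zero; suc; toℕ)
open import Data.Fin.Permutation using (↔⇒≡)
open import Data.Fin.Properties using (_≟_; suc-injective; <-cmp)
open import Data.List.Base using (List; []; _∷_; _++_; length; lookup; map; filterᵇ; allFin; cartesianProduct)
open import Data.List.Membership.Propositional using (_∈_; lose)
open import Data.List.Membership.Propositional.Properties using (∈-allFin; ∈-cartesianProduct⁺)
open import Data.List.Properties using (filter-++; filter-some; filter-≐; length-++)
open import Data.List.Relation.Unary.Any using (Any; here; there)
open import Data.Nat.Base using (ℕ; zero; suc; _+_; _*_; _≤_; _<_; _<ᵇ_; z≤n; s≤s; s≤s⁻¹)
open import Data.Nat.Properties
  using (<ᵇ⇒<; <⇒<ᵇ; <-irrefl; <-asym; ≤-<-trans; ≤-total; m≤n⇒m≤1+n)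
open import Data.Product.Base using (Σ; _×_; _,_; proj₁; proj₂)
open import Data.Sum.Base using (_⊎_; inj₁; inj₂; swap; [_,_]′)
open import Function.Base using (_∘_)
open import Function.Bundles using (Equivalence; Inverse; _↔_; _⇔_; mk↔ₛ′; mk⇔)
open import Function.Properties.Inverse using (↔-sym; ↔-trans)
open import Relation.Binary.Definitions using (tri<; tri≈; tri>)
open import Relation.Binary.PropositionalEquality
  using (_≡_; _≢_; refl; sym; trans; cong; cong₂; subst; module ≡-Reasoning)
open import Relation.Nullary using (¬_; Dec; yes; no)
open import Relation.Nullary.Decidable using (T?; toSum)

open Equivalence using (to; from)

T-eqᵇ⇒≡ : ∀ {k} {c d : Fin k} → T (eqᵇ c d) → c ≡ d
T-eqᵇ⇒≡ {c = c} {d} t with c ≟ d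
... | yes c≡d = c≡d

≡⇒T-eqᵇ : ∀ {k} {c d : Fin k} → c ≡ d → T (eqᵇ c d)
≡⇒T-eqᵇ {c = c} {d} c≡d with c ≟ d
... | yes _   = _
... | no  c≢d = c≢d c≡d

eqᵇ-refl : ∀ {k} (c : Fin k) → eqᵇ c c ≡ true
eqᵇ-refl c with c ≟ c
... | yes _   = refl
... | no  c≢c = ⊥-elim (c≢c refl)

¬T⇒≡false : ∀ {b} → ¬ T b → b ≡ false
¬T⇒≡false {false} _ = refl
¬T⇒≡false {true} ¬t = ⊥-elim (¬t _)

T-∧-intro : ∀ {x y} → T x → T y → T (x ∧ y)
T-∧-intro {true} _ t = t

T-∨-introˡ : ∀ {x} y → T x → T (x ∨ y)
T-∨-introˡ {true} _ _ = _

T-∨-introʳ : ∀ x {y} → T y → T (x ∨ y)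
T-∨-introʳ true  _ = _
T-∨-introʳ false t = t

¬T⇒T-not : ∀ {x} → ¬ T x → T (not x)
¬T⇒T-not {false} _  = _
¬T⇒T-not {true}  ¬t = ¬t _

T-not⇒¬T : ∀ {x} → T (not x) → ¬ T x
T-not⇒¬T {false} _ ()

∧-T-identityʳ : ∀ x {y} → T y → x ∧ y ≡ x
∧-T-identityʳ x {true} _ = ∧-identityʳ x

T-injective : ∀ {x y} → (T x → T y) → (T y → T x) → x ≡ y
T-injective {false} {false} _ _ = refl
T-injective {false} {true}  _ g = ⊥-elim (g _)
T-injective {true}  {false} f _ = ⊥-elim (f _)
T-injective {true}  {true}  _ _ = refl

module _ {A : Set} {P Q : A → Bool} (P⊆Q : ∀ x → T (P x) → T (Q x)) where

  length-filterᵇ-mono : ∀ xs → length (filterᵇ P xs) ≤ length (filterᵇ Q xs)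
  length-filterᵇ-mono []       = z≤n
  length-filterᵇ-mono (x ∷ xs) with P x | Q x | P⊆Q x
  ... | true  | true  | _ = s≤s (length-filterᵇ-mono xs)
  ... | true  | false | h = ⊥-elim (h _)
  ... | false | true  | _ = m≤n⇒m≤1+n (length-filterᵇ-mono xs)
  ... | false | false | _ = length-filterᵇ-mono xs

  length-filterᵇ-< : ∀ {xs} → Any (λ x → T (Q x) × ¬ T (P x)) xs →
            length (filterᵇ P xs) < length (filterᵇ Q xs)
  length-filterᵇ-< {x ∷ xs} (here (qx , ¬px)) with P x | Q x | P⊆Q x
  ... | true  | _     | _ = ⊥-elim (¬px _)
  ... | false | true  | _ = s≤s (length-filterᵇ-mono xs)
  ... | false | false | _ = ⊥-elim qx
  length-filterᵇ-< {x ∷ xs} (there any) with P x | Q x | P⊆Q x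
  ... | true  | true  | _ = s≤s (length-filterᵇ-< any)
  ... | true  | false | h = ⊥-elim (h _)
  ... | false | true  | _ = m≤n⇒m≤1+n (length-filterᵇ-< any)
  ... | false | false | _ = length-filterᵇ-< any

  length-filterᵇ-<⁻ : ∀ xs → length (filterᵇ P xs) < length (filterᵇ Q xs) →
             Σ A λ x → T (Q x) × ¬ T (P x)
  length-filterᵇ-<⁻ (x ∷ xs) lt with P x in px | Q x in qx | P⊆Q x
  ... | true  | true  | _ = length-filterᵇ-<⁻ xs (s≤s⁻¹ lt)
  ... | true  | false | h = ⊥-elim (h _)
  ... | false | true  | _ = x , from T-≡ qx , λ t → subst T px t
  ... | false | false | _ = length-filterᵇ-<⁻ xs lt

length-filterᵇ-pos⁻ : ∀ {A : Set} {P : A → Bool} xs → 0 < length (filterᵇ P xs) → Σ A (T ∘ P)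
length-filterᵇ-pos⁻ {P = P} (x ∷ xs) pos with P x in px
... | true  = x , from T-≡ px
... | false = length-filterᵇ-pos⁻ xs pos

length-filterᵇ-false : ∀ {A : Set} (xs : List A) → length (filterᵇ (λ _ → false) xs) ≡ 0
length-filterᵇ-false []       = refl
length-filterᵇ-false (_ ∷ xs) = length-filterᵇ-false xs

length-filterᵇ-map : ∀ {A B : Set} (P : B → Bool) (f : A → B) xs →
            length (filterᵇ P (map f xs)) ≡ length (filterᵇ (P ∘ f) xs)
length-filterᵇ-map P f []       = refl
length-filterᵇ-map P f (x ∷ xs) with P (f x)
... | true  = cong suc (length-filterᵇ-map P f xs)
... | false = length-filterᵇ-map P f xs

length-filterᵇ-cartesianProduct : ∀ {A B : Set} (P : A → Bool) (Q : B → Bool) xs ys →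
  length (filterᵇ (λ p → P (proj₁ p) ∧ Q (proj₂ p)) (cartesianProduct xs ys)) ≡
  length (filterᵇ P xs) * length (filterᵇ Q ys)
length-filterᵇ-cartesianProduct P Q []       ys = refl
length-filterᵇ-cartesianProduct P Q (x ∷ xs) ys = begin
    length (filterᵇ R (map (x ,_) ys ++ cartesianProduct xs ys))
  ≡⟨ cong length (filter-++ (λ p → T? (R p)) (map (x ,_) ys) _) ⟩
    length (filterᵇ R (map (x ,_) ys) ++ filterᵇ R (cartesianProduct xs ys))
  ≡⟨ length-++ (filterᵇ R (map (x ,_) ys)) ⟩
    length (filterᵇ R (map (x ,_) ys)) + length (filterᵇ R (cartesianProduct xs ys))
  ≡⟨ cong₂ _+_ (length-filterᵇ-map R (x ,_) ys) (length-filterᵇ-cartesianProduct P Q xs ys) ⟩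
    length (filterᵇ (λ y → P x ∧ Q y) ys) + length (filterᵇ P xs) * length (filterᵇ Q ys)
  ≡⟨ row ⟩
    length (filterᵇ P (x ∷ xs)) * length (filterᵇ Q ys) ∎
  where
  open ≡-Reasoning
  R = λ p → P (proj₁ p) ∧ Q (proj₂ p)
  row : length (filterᵇ (λ y → P x ∧ Q y) ys) + length (filterᵇ P xs) * length (filterᵇ Q ys) ≡
        length (filterᵇ P (x ∷ xs)) * length (filterᵇ Q ys)
  row with P x
  ... | true  = refl
  ... | false = cong (_+ length (filterᵇ P xs) * length (filterᵇ Q ys)) (length-filterᵇ-false ys)

Σ-T-≡ : ∀ {A : Set} {P : A → Bool} {s s′ : Σ A (T ∘ P)} → proj₁ s ≡ proj₁ s′ → s ≡ s′
Σ-T-≡ {s = x , p} {.x , q} refl = cong (x ,_) (T-irrelevant p q)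

count : ∀ {m} → (Fin m → Bool) → ℕ
count {zero}  P = 0
count {suc m} P = if P zero then suc (count (P ∘ suc)) else count (P ∘ suc)

module Enumeration where

  index : ∀ {m} (P : Fin m → Bool) i → T (P i) → Fin (count P)
  index P zero    p with P zero
  ... | true = zero
  index P (suc i) p with P zero
  ... | true  = suc (index (P ∘ suc) i p)
  ... | false = index (P ∘ suc) i p

  element : ∀ {m} (P : Fin m → Bool) → Fin (count P) → Fin m
  element {suc m} P j with P zero
  ... | true with j
  ...   | zero   = zero
  ...   | suc j′ = suc (element (P ∘ suc) j′)
  element {suc m} P j | false = suc (element (P ∘ suc) j)

  P-element : ∀ {m} (P : Fin m → Bool) j → T (P (element P j))
  P-element {suc m} P j with P zero in p0
  ... | true with j
  ...   | zero   = from T-≡ p0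
  ...   | suc j′ = P-element (P ∘ suc) j′
  P-element {suc m} P j | false = P-element (P ∘ suc) j

  element-index : ∀ {m} (P : Fin m → Bool) i p → element P (index P i p) ≡ i
  element-index P zero    p with P zero
  ... | true = refl
  element-index P (suc i) p with P zero
  ... | true  = cong suc (element-index (P ∘ suc) i p)
  ... | false = cong suc (element-index (P ∘ suc) i p)

  element-injective : ∀ {m} (P : Fin m → Bool) {j j′} → element P j ≡ element P j′ → j ≡ j′
  element-injective {suc m} P {j} {j′} eq with P zero
  ... | true with j | j′
  ...   | zero  | zero  = refl
  ...   | suc i | suc i′ = cong suc (element-injective (P ∘ suc) (suc-injective eq))
  element-injective {suc m} P eq | false = element-injective (P ∘ suc) (suc-injective eq)

  Σ↔count : ∀ {m} (P : Fin m → Bool) → Σ (Fin m) (T ∘ P) ↔ Fin (count P)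
  Σ↔count P = mk↔ₛ′ (λ (i , p) → index P i p) (λ j → element P j , P-element P j)
    (λ j → element-injective P (element-index P (element P j) (P-element P j)))
    (λ (i , p) → Σ-T-≡ (element-index P i p))

open Enumeration using (Σ↔count)

count-cong : ∀ {m m′} {P : Fin m → Bool} {Q : Fin m′ → Bool} →
             Σ (Fin m) (T ∘ P) ↔ Σ (Fin m′) (T ∘ Q) → count P ≡ count Q
count-cong {P = P} {Q} f = ↔⇒≡ (↔-trans (↔-sym (Σ↔count P)) (↔-trans f (Σ↔count Q)))

count-mono : ∀ {m} {P Q : Fin m → Bool} → (∀ i → T (P i) → T (Q i)) → count P ≤ count Q
count-mono {zero}          _   = z≤n
count-mono {suc m} {P} {Q} P⊆Q with P zero | Q zero | P⊆Q zero
... | true  | true  | _ = s≤s (count-mono (P⊆Q ∘ suc))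
... | true  | false | h = ⊥-elim (h _)
... | false | true  | _ = m≤n⇒m≤1+n (count-mono (P⊆Q ∘ suc))
... | false | false | _ = count-mono (P⊆Q ∘ suc)

count-< : ∀ {m} {P Q : Fin m → Bool} → (∀ i → T (P i) → T (Q i)) →
          ∀ i → T (Q i) → ¬ T (P i) → count P < count Q
count-< {suc m} {P} {Q} P⊆Q zero q ¬p with P zero | Q zero | P⊆Q zero
... | true  | _     | _ = ⊥-elim (¬p _)
... | false | true  | _ = s≤s (count-mono (P⊆Q ∘ suc))
... | false | false | _ = ⊥-elim q
count-< {suc m} {P} {Q} P⊆Q (suc i) q ¬p with P zero | Q zero | P⊆Q zero
... | true  | true  | _ = s≤s (count-< (P⊆Q ∘ suc) i q ¬p)
... | true  | false | h = ⊥-elim (h _)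
... | false | true  | _ = m≤n⇒m≤1+n (count-< (P⊆Q ∘ suc) i q ¬p)
... | false | false | _ = count-< (P⊆Q ∘ suc) i q ¬p

count-≡⇒⊇ : ∀ {m} {P Q : Fin m → Bool} → (∀ i → T (P i) → T (Q i)) → count P ≡ count Q →
            ∀ i → T (Q i) → T (P i)
count-≡⇒⊇ {P = P} P⊆Q eq i q with T? (P i)
... | yes p  = p
... | no  ¬p = ⊥-elim (<-irrefl eq (count-< P⊆Q i q ¬p))

-- Runs and positions in filtered words

module _ {k} (c : Fin k) where

  runs-≥1 : ∀ zs (l : Fin (length zs)) → lookup zs l ≡ c → 1 ≤ runs c zs
  runs-≥1 (x ∷ xs) zero    xc with x ≟ c
  ... | yes _   = s≤s z≤n
  ... | no  x≢c = ⊥-elim (x≢c xc)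
  runs-≥1 (x ∷ xs) (suc l) lc with x ≟ c
  ... | yes _ = s≤s z≤n
  ... | no  _ = runs-≥1 xs l lc

  runs-after-gap : ∀ started zs (j l : Fin (length zs)) → toℕ j < toℕ l →
                   lookup zs j ≢ c → lookup zs l ≡ c → 1 ≤ runsAux c started zs
  runs-after-gap started (x ∷ xs) zero (suc l) _ x≢c lc with x ≟ c
  ... | yes x≡c = ⊥-elim (x≢c x≡c)
  ... | no  _   = runs-≥1 xs l lc
  runs-after-gap started (x ∷ xs) (suc j) (suc l) (s≤s j<l) jc lc with x ≟ c | started
  ... | yes _ | true  = runs-after-gap true xs j l j<l jc lc
  ... | yes _ | false = s≤s z≤n
  ... | no  _ | _     = runs-after-gap false xs j l j<l jc lc

  runs-≥2 : ∀ zs (i j l : Fin (length zs)) → toℕ i < toℕ j → toℕ j < toℕ l →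
            lookup zs i ≡ c → lookup zs j ≢ c → lookup zs l ≡ c → 2 ≤ runs c zs
  runs-≥2 (x ∷ xs) zero (suc j) (suc l) _ (s≤s j<l) xc jc lc with x ≟ c
  ... | yes _   = s≤s (runs-after-gap true xs j l j<l jc lc)
  ... | no  x≢c = ⊥-elim (x≢c xc)
  runs-≥2 (x ∷ xs) (suc i) (suc j) (suc l) (s≤s i<j) (s≤s j<l) ic jc lc with x ≟ c
  ... | yes _ = s≤s (runs-after-gap true xs j l j<l jc lc)
  ... | no  _ = runs-≥2 xs i j l i<j j<l ic jc lc

module FilterPositions {A : Set} (P : A → Bool) where

  inject : ∀ xs → Fin (length (filterᵇ P xs)) → Fin (length xs)
  inject (x ∷ xs) i with P x
  ... | true with i
  ...   | zero   = zero
  ...   | suc i′ = suc (inject xs i′)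
  inject (x ∷ xs) i | false = suc (inject xs i)

  project : ∀ xs (j : Fin (length xs)) → T (P (lookup xs j)) → Fin (length (filterᵇ P xs))
  project (x ∷ xs) zero    p with P x
  ... | true = zero
  project (x ∷ xs) (suc j) p with P x
  ... | true  = suc (project xs j p)
  ... | false = project xs j p

  lookup-inject : ∀ xs i → lookup xs (inject xs i) ≡ lookup (filterᵇ P xs) i
  lookup-inject (x ∷ xs) i with P x
  ... | true with i
  ...   | zero   = refl
  ...   | suc i′ = lookup-inject xs i′
  lookup-inject (x ∷ xs) i | false = lookup-inject xs i

  P-inject : ∀ xs i → T (P (lookup xs (inject xs i)))
  P-inject (x ∷ xs) i with P x in px
  ... | true with i
  ...   | zero   = from T-≡ px
  ...   | suc i′ = P-inject xs i′
  P-inject (x ∷ xs) i | false = P-inject xs i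

  inject-project : ∀ xs j p → inject xs (project xs j p) ≡ j
  inject-project (x ∷ xs) zero    p with P x
  ... | true = refl
  inject-project (x ∷ xs) (suc j) p with P x
  ... | true  = cong suc (inject-project xs j p)
  ... | false = cong suc (inject-project xs j p)

  inject-injective : ∀ xs {i j} → inject xs i ≡ inject xs j → i ≡ j
  inject-injective (x ∷ xs) {i} {j} eq with P x
  ... | true with i | j
  ...   | zero   | zero   = refl
  ...   | suc i′ | suc j′ = cong suc (inject-injective xs (suc-injective eq))
  inject-injective (x ∷ xs) eq | false = inject-injective xs (suc-injective eq)

  project-inject : ∀ xs i p → project xs (inject xs i) p ≡ i
  project-inject xs i p = inject-injective xs (inject-project xs (inject xs i) p)

  lookup-project : ∀ xs j p → lookup (filterᵇ P xs) (project xs j p) ≡ lookup xs j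
  lookup-project xs j p = trans (sym (lookup-inject xs _)) (cong (lookup xs) (inject-project xs j p))

  inject-<ᵇ : ∀ xs i j → (toℕ (inject xs i) <ᵇ toℕ (inject xs j)) ≡ (toℕ i <ᵇ toℕ j)
  inject-<ᵇ (x ∷ xs) i j with P x
  ... | true with i | j
  ...   | zero   | zero   = refl
  ...   | zero   | suc _  = refl
  ...   | suc _  | zero   = refl
  ...   | suc i′ | suc j′ = inject-<ᵇ xs i′ j′
  inject-<ᵇ (x ∷ xs) i j | false = inject-<ᵇ xs i j

  project-< : ∀ xs {j j′} p p′ → toℕ j < toℕ j′ →
              toℕ (project xs j p) < toℕ (project xs j′ p′)
  project-< xs {j} {j′} p p′ j<j′ = <ᵇ⇒< _ _ (subst T (begin
      toℕ j <ᵇ toℕ j′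
    ≡⟨ sym (cong₂ (λ i i′ → toℕ i <ᵇ toℕ i′) (inject-project xs j p)
                                               (inject-project xs j′ p′)) ⟩
      toℕ (inject xs (project xs j p)) <ᵇ toℕ (inject xs (project xs j′ p′))
    ≡⟨ inject-<ᵇ xs _ _ ⟩
      toℕ (project xs j p) <ᵇ toℕ (project xs j′ p′) ∎) (<⇒<ᵇ j<j′))
    where open ≡-Reasoning

runs-pairL-≥2 : ∀ {k} {a b : Fin k} w {y x y′} → a ≢ b → toℕ y < toℕ x → toℕ x < toℕ y′ →
  lookup w y ≡ b → lookup w x ≡ a → lookup w y′ ≡ b → 2 ≤ runs b (sub (pairL b a) w)
runs-pairL-≥2 {a = a} {b} w {y} {x} {y′} a≢b y<x x<y′ wy wx wy′ =
  runs-≥2 b (sub (pairL b a) w) (project w y py) (project w x px) (project w y′ py′)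
    (project-< w py px y<x) (project-< w px py′ x<y′)
    (trans (lookup-project w y py) wy)
    (λ xb → a≢b (trans (sym wx) (trans (sym (lookup-project w x px)) xb)))
    (trans (lookup-project w y′ py′) wy′)
  where
  open FilterPositions (pairL b a)
  py = T-∨-introˡ _ (≡⇒T-eqᵇ wy)
  px = T-∨-introʳ (eqᵇ (lookup w x) b) (≡⇒T-eqᵇ wx)
  py′ = T-∨-introˡ _ (≡⇒T-eqᵇ wy′)

sub-pairL-comm : ∀ {k} (a b : Fin k) w → sub (pairL a b) w ≡ sub (pairL b a) w
sub-pairL-comm a b w =
  filter-≐ (T? ∘ pairL a b) (T? ∘ pairL b a) ((λ {c} → pairL-swap a b c) , (λ {c} → pairL-swap b a c)) w
  where
  pairL-swap : ∀ a b c → T (pairL a b c) → T (pairL b a c)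
  pairL-swap a b c = subst T (∨-comm (eqᵇ c a) (eqᵇ c b))

-- Letter graphs

module _ {k} (D : Fin k → Fin k → Bool) (w : List (Fin k)) where

  letterAdj-sym : ∀ x y → letterAdj D w x y ≡ letterAdj D w y x
  letterAdj-sym x y = ∨-comm ((toℕ x <ᵇ toℕ y) ∧ D (lookup w x) (lookup w y))
                             ((toℕ y <ᵇ toℕ x) ∧ D (lookup w y) (lookup w x))

  letterAdj-irrefl : ∀ x → letterAdj D w x x ≡ false
  letterAdj-irrefl x rewrite ¬T⇒≡false (<-irrefl refl ∘ <ᵇ⇒< (toℕ x) (toℕ x)) = refl

  letterAdj-< : ∀ {x y} → toℕ x < toℕ y → letterAdj D w x y ≡ D (lookup w x) (lookup w y)
  letterAdj-< {x} {y} x<y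
    rewrite to T-≡ (<⇒<ᵇ x<y) | ¬T⇒≡false (<-asym x<y ∘ <ᵇ⇒< (toℕ y) (toℕ x))
    = ∨-identityʳ _

  letterAdj-> : ∀ {x y} → toℕ y < toℕ x → letterAdj D w x y ≡ D (lookup w y) (lookup w x)
  letterAdj-> {x} {y} y<x = trans (letterAdj-sym x y) (letterAdj-< y<x)

  letterAdj-same-letter : ∀ {x y c} → x ≢ y → lookup w x ≡ c → lookup w y ≡ c →
                          letterAdj D w x y ≡ D c c
  letterAdj-same-letter {x} {y} x≢y refl wy with <-cmp x y
  ... | tri< x<y _ _ = trans (letterAdj-< x<y) (cong (D _) wy)
  ... | tri≈ _ x≡y _ = ⊥-elim (x≢y x≡y)
  ... | tri> _ _ y<x = trans (letterAdj-> y<x) (cong (λ c → D c _) wy)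

  letterAdj-same-letter-≡ : ∀ {x y x′ y′ c} → (x ≡ y → x′ ≡ y′) → (x′ ≡ y′ → x ≡ y) →
    lookup w x ≡ c → lookup w y ≡ c → lookup w x′ ≡ c → lookup w y′ ≡ c →
    letterAdj D w x y ≡ letterAdj D w x′ y′
  letterAdj-same-letter-≡ {x} {y} {x′} {y′} x≡y⇒x′≡y′ x′≡y′⇒x≡y wx wy wx′ wy′ with x ≟ y
  ... | yes refl rewrite x≡y⇒x′≡y′ refl = trans (letterAdj-irrefl x) (sym (letterAdj-irrefl y′))
  ... | no  x≢y  = trans (letterAdj-same-letter x≢y wx wy)
                         (sym (letterAdj-same-letter (x≢y ∘ x′≡y′⇒x≡y) wx′ wy′))

  letterAdj-∧ : ∀ (cond : Fin k → Fin k → Bool) → (∀ c d → cond c d ≡ cond d c) → ∀ x y →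
    letterAdj (λ c d → D c d ∧ cond c d) w x y ≡ letterAdj D w x y ∧ cond (lookup w x) (lookup w y)
  letterAdj-∧ cond cond-sym x y = sym (begin
      ((x<y ∧ D a b) ∨ (y<x ∧ D b a)) ∧ cond a b
    ≡⟨ ∧-distribʳ-∨ (cond a b) (x<y ∧ D a b) (y<x ∧ D b a) ⟩
      ((x<y ∧ D a b) ∧ cond a b) ∨ ((y<x ∧ D b a) ∧ cond a b)
    ≡⟨ cong₂ _∨_ (∧-assoc x<y (D a b) (cond a b)) (∧-assoc y<x (D b a) (cond a b)) ⟩
      (x<y ∧ D a b ∧ cond a b) ∨ (y<x ∧ D b a ∧ cond a b)
    ≡⟨ cong (λ e → (x<y ∧ D a b ∧ cond a b) ∨ (y<x ∧ D b a ∧ e)) (cond-sym a b) ⟩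
      (x<y ∧ D a b ∧ cond a b) ∨ (y<x ∧ D b a ∧ cond b a) ∎)
    where
    open ≡-Reasoning
    a = lookup w x
    b = lookup w y
    x<y = toℕ x <ᵇ toℕ y
    y<x = toℕ y <ᵇ toℕ x

  letterAdj-distinct : ∀ {a b x y} → a ≢ b → lookup w x ≡ a → lookup w y ≡ b →
    toℕ x < toℕ y × letterAdj D w x y ≡ D a b ⊎ toℕ y < toℕ x × letterAdj D w x y ≡ D b a
  letterAdj-distinct {x = x} {y} a≢b refl refl with <-cmp x y
  ... | tri< x<y _ _  = inj₁ (x<y , letterAdj-< x<y)
  ... | tri≈ _ refl _ = ⊥-elim (a≢b refl)
  ... | tri> _ _ y<x  = inj₂ (y<x , letterAdj-> y<x)

  letterAdj-same-side : ∀ {a b x y y′} → a ≢ b →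
    lookup w x ≡ a → lookup w y ≡ b → lookup w y′ ≡ b →
    ¬ (toℕ y < toℕ x × toℕ x < toℕ y′) → ¬ (toℕ y′ < toℕ x × toℕ x < toℕ y) →
    letterAdj D w x y ≡ letterAdj D w x y′
  letterAdj-same-side a≢b wx wy wy′ y<x<y′ y′<x<y
    with letterAdj-distinct a≢b wx wy | letterAdj-distinct a≢b wx wy′
  ... | inj₁ (_ , e)   | inj₁ (_ , e′)   = trans e (sym e′)
  ... | inj₂ (_ , e)   | inj₂ (_ , e′)   = trans e (sym e′)
  ... | inj₁ (x<y , _) | inj₂ (y′<x , _) = ⊥-elim (y′<x<y (y′<x , x<y))
  ... | inj₂ (y<x , _) | inj₁ (x<y′ , _) = ⊥-elim (y<x<y′ (y<x , x<y′))

  -- Moving x to the right only shrinks the set of b-positions after x and grows the set before it.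
  letterAdj-nested : ∀ {a b x x′} → a ≢ b →
    lookup w x ≡ a → lookup w x′ ≡ a → toℕ x ≤ toℕ x′ →
    (∀ y → lookup w y ≡ b → T (letterAdj D w x y) → T (letterAdj D w x′ y)) ⊎
    (∀ y → lookup w y ≡ b → T (letterAdj D w x′ y) → T (letterAdj D w x y))
  letterAdj-nested {a} {b} {x} {x′} a≢b wx wx′ x≤x′ with D a b in ab | D b a in ba
  ... | false | _     = inj₁ grows
    where
    grows : ∀ y → lookup w y ≡ b → T (letterAdj D w x y) → T (letterAdj D w x′ y)
    grows y wy t with letterAdj-distinct a≢b wx wy | letterAdj-distinct a≢b wx′ wy
    ... | inj₁ (_ , e)   | _               = ⊥-elim (subst T (trans e ab) t)
    ... | inj₂ (y<x , _) | inj₁ (x′<y , _) = ⊥-elim (<-asym y<x (≤-<-trans x≤x′ x′<y))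
    ... | inj₂ (_ , e)   | inj₂ (_ , e′)   = subst T (trans e (sym e′)) t
  ... | true  | true  = inj₁ everywhere
    where
    everywhere : ∀ y → lookup w y ≡ b → T (letterAdj D w x y) → T (letterAdj D w x′ y)
    everywhere y wy _ with letterAdj-distinct a≢b wx′ wy
    ... | inj₁ (_ , e) = subst T (sym (trans e ab)) _
    ... | inj₂ (_ , e) = subst T (sym (trans e ba)) _
  ... | true  | false = inj₂ shrinks
    where
    shrinks : ∀ y → lookup w y ≡ b → T (letterAdj D w x′ y) → T (letterAdj D w x y)
    shrinks y wy t with letterAdj-distinct a≢b wx wy | letterAdj-distinct a≢b wx′ wy
    ... | _              | inj₂ (_ , e′)   = ⊥-elim (subst T (trans e′ ba) t)
    ... | inj₂ (y<x , _) | inj₁ (x′<y , _) = ⊥-elim (<-asym y<x (≤-<-trans x≤x′ x′<y))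
    ... | inj₁ (_ , e)   | inj₁ (_ , e′)   = subst T (trans e′ (sym e)) t

  letterAdj-comparable : ∀ {a b x x′} → a ≢ b → lookup w x ≡ a → lookup w x′ ≡ a →
    (∀ y → lookup w y ≡ b → T (letterAdj D w x y) → T (letterAdj D w x′ y)) ⊎
    (∀ y → lookup w y ≡ b → T (letterAdj D w x′ y) → T (letterAdj D w x y))
  letterAdj-comparable {x = x} {x′} a≢b wx wx′ with ≤-total (toℕ x) (toℕ x′)
  ... | inj₁ x≤x′ = letterAdj-nested a≢b wx wx′ x≤x′
  ... | inj₂ x′≤x = swap (letterAdj-nested a≢b wx′ wx x′≤x)

  letterAdj-⊆-count-≡ : ∀ {b x x′} →
    (∀ y → lookup w y ≡ b → T (letterAdj D w x y) → T (letterAdj D w x′ y)) →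
    count (λ y → eqᵇ (lookup w y) b ∧ letterAdj D w x y) ≡
    count (λ y → eqᵇ (lookup w y) b ∧ letterAdj D w x′ y) →
    ∀ y → lookup w y ≡ b → letterAdj D w x y ≡ letterAdj D w x′ y
  letterAdj-⊆-count-≡ x⊆x′ same-count y wy =
    T-injective (x⊆x′ y wy) (λ t → proj₂ (to T-∧ (x′⊆x y (T-∧-intro (≡⇒T-eqᵇ wy) t))))
    where
    x′⊆x = count-≡⇒⊇ (λ y t → let (wy , adj) = to T-∧ t in T-∧-intro wy (x⊆x′ y (T-eqᵇ⇒≡ wy) adj))
                     same-count

  letterAdj-count-≡ : ∀ {a b x x′} → a ≢ b → lookup w x ≡ a → lookup w x′ ≡ a →
    count (λ y → eqᵇ (lookup w y) b ∧ letterAdj D w x y) ≡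
    count (λ y → eqᵇ (lookup w y) b ∧ letterAdj D w x′ y) →
    ∀ y → lookup w y ≡ b → letterAdj D w x y ≡ letterAdj D w x′ y
  letterAdj-count-≡ a≢b wx wx′ same-count with letterAdj-comparable a≢b wx wx′
  ... | inj₁ x⊆x′ = letterAdj-⊆-count-≡ x⊆x′ same-count
  ... | inj₂ x′⊆x = λ y wy → sym (letterAdj-⊆-count-≡ x′⊆x (sym same-count) y wy)

module _ {k} (D : Fin k → Fin k → Bool) (S : Fin k → Bool) where
  open FilterPositions S

  letterAdj-filter : ∀ w i j → letterAdj D (filterᵇ S w) i j ≡ letterAdj D w (inject w i) (inject w j)
  letterAdj-filter w i j
    rewrite inject-<ᵇ w i j | inject-<ᵇ w j i | lookup-inject w i | lookup-inject w j = refl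

-- One-sided letter pairs

module OneSided {n k} (E : Fin n → Fin n → Bool) (χ : Fin n → Fin k) where

  CrossPair : Fin k → Fin k → Bool → Set
  CrossPair a b e = Σ (Fin n) λ u → Σ (Fin n) λ v → χ u ≡ a × χ v ≡ b × E u v ≡ e

  private
    InColours : Fin k → Fin k → Fin n × Fin n → Bool
    InColours a b (u , v) = eqᵇ (χ u) a ∧ eqᵇ (χ v) b

    Edge : Fin k → Fin k → Fin n × Fin n → Bool
    Edge a b (u , v) = eqᵇ (χ u) a ∧ eqᵇ (χ v) b ∧ E u v

    Edge⊆InColours : ∀ {a b} p → T (Edge a b p) → T (InColours a b p)
    Edge⊆InColours {a} {b} (u , v) t with eqᵇ (χ u) a | eqᵇ (χ v) b
    ... | true | true = _

    pairs = cartesianProduct (allFin n) (allFin n)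

    ∈-pairs : ∀ u v → (u , v) ∈ pairs
    ∈-pairs u v = ∈-cartesianProduct⁺ (∈-allFin u) (∈-allFin v)

    in-colours : ∀ {u v} → T (InColours (χ u) (χ v) (u , v))
    in-colours {u} {v} rewrite eqᵇ-refl (χ u) | eqᵇ-refl (χ v) = _

    edge : ∀ {u v} → E u v ≡ true → T (Edge (χ u) (χ v) (u , v))
    edge {u} {v} e rewrite eqᵇ-refl (χ u) | eqᵇ-refl (χ v) | e = _

    non-edge : ∀ {u v} → E u v ≡ false → ¬ T (Edge (χ u) (χ v) (u , v))
    non-edge {u} {v} e rewrite eqᵇ-refl (χ u) | eqᵇ-refl (χ v) | e = λ ()

    edge⁻ : ∀ {a b} p → T (Edge a b p) → CrossPair a b true
    edge⁻ {a} {b} (u , v) t with χ u ≟ a | χ v ≟ b | E u v in e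
    ... | yes cu | yes cv | true = u , v , cu , cv , e

    non-edge⁻ : ∀ {a b} p → T (InColours a b p) → ¬ T (Edge a b p) → CrossPair a b false
    non-edge⁻ {a} {b} (u , v) c ¬t with χ u ≟ a | χ v ≟ b | E u v in e
    ... | yes cu | yes cv | false = u , v , cu , cv , e
    ... | yes cu | yes cv | true  = ⊥-elim (¬t _)

    oneSided-counts : ∀ a b → oneSided E χ a b ≡
      (0 <ᵇ length (filterᵇ (Edge a b) pairs)) ∧
      (length (filterᵇ (Edge a b) pairs) <ᵇ length (filterᵇ (InColours a b) pairs))
    oneSided-counts a b =
      cong (λ m → (0 <ᵇ crossEdges E χ a b) ∧ (crossEdges E χ a b <ᵇ m))
           (sym (length-filterᵇ-cartesianProduct (λ u → eqᵇ (χ u) a) (λ v → eqᵇ (χ v) b)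
                                                 (allFin n) (allFin n)))

  oneSided-intro : ∀ {a b} → CrossPair a b true → CrossPair a b false → T (oneSided E χ a b)
  oneSided-intro {a} {b} (u , v , refl , refl , e) (u′ , v′ , cu′ , cv′ , e′) =
    subst T (sym (oneSided-counts a b)) (from T-∧ (<⇒<ᵇ some-edge , <⇒<ᵇ some-non-edge))
    where
    some-edge : 0 < length (filterᵇ (Edge a b) pairs)
    some-edge = filter-some (T? ∘ Edge a b) (lose (∈-pairs u v) (edge e))

    some-non-edge : length (filterᵇ (Edge a b) pairs) < length (filterᵇ (InColours a b) pairs)
    some-non-edge rewrite sym cu′ | sym cv′ =
      length-filterᵇ-< Edge⊆InColours (lose (∈-pairs u′ v′) (in-colours , non-edge e′))

  oneSided-elim : ∀ {a b} → T (oneSided E χ a b) → CrossPair a b true × CrossPair a b false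
  oneSided-elim {a} {b} t
    with (some-edge , some-non-edge) ← to T-∧ (subst T (oneSided-counts a b) t)
    with (p , p-edge) ← length-filterᵇ-pos⁻ pairs (<ᵇ⇒< _ _ some-edge)
       | (p′ , p′-colours , p′-non-edge)
           ← length-filterᵇ-<⁻ Edge⊆InColours pairs (<ᵇ⇒< _ _ some-non-edge)
    = edge⁻ p p-edge , non-edge⁻ p′ p′-colours p′-non-edge

  oneSided-sym : (∀ u v → E u v ≡ E v u) → ∀ {a b} → T (oneSided E χ a b) → T (oneSided E χ b a)
  oneSided-sym E-sym t with oneSided-elim t
  ... | (u , v , cu , cv , e) , (u′ , v′ , cu′ , cv′ , e′) =
    oneSided-intro (v , u , cv , cu , trans (E-sym v u) e)
                   (v′ , u′ , cv′ , cu′ , trans (E-sym v′ u′) e′)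

  ¬oneSided⇒constant : ∀ {a b} → ¬ T (oneSided E χ a b) → ∀ {u v u′ v′} →
    χ u ≡ a → χ v ≡ b → χ u′ ≡ a → χ v′ ≡ b → E u v ≡ E u′ v′
  ¬oneSided⇒constant ¬os {u} {v} {u′} {v′} cu cv cu′ cv′ with E u v in e | E u′ v′ in e′
  ... | true  | true  = refl
  ... | false | false = refl
  ... | true  | false = ⊥-elim (¬os (oneSided-intro (u , v , cu , cv , e) (u′ , v′ , cu′ , cv′ , e′)))
  ... | false | true  = ⊥-elim (¬os (oneSided-intro (u′ , v′ , cu′ , cv′ , e′) (u , v , cu , cv , e)))

-- A sub-solution for the letters S, read in the positions of w instead of those of w[S].
record Placement {V : Set} {k} (χ : V → Fin k) (w : List (Fin k)) (S : Fin k → Bool) : Set where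
  field
    position        : ∀ v → T (S (χ v)) → Fin (length w)
    vertex          : ∀ y → T (S (lookup w y)) → V
    lookup-position : ∀ v p → lookup w (position v p) ≡ χ v
    χ-vertex        : ∀ y q → χ (vertex y q) ≡ lookup w y
    position-vertex : ∀ y q p → position (vertex y q) p ≡ y
    vertex-position : ∀ v p q → vertex (position v p) q ≡ v

  position-cong : ∀ {u v} p q → u ≡ v → position u p ≡ position v q
  position-cong p q refl = cong (position _) (T-irrelevant p q)

  vertex-cong : ∀ {y y′} q q′ → y ≡ y′ → vertex y q ≡ vertex y′ q′
  vertex-cong q q′ refl = cong (vertex _) (T-irrelevant q q′)

  S-position : ∀ v p → T (S (lookup w (position v p)))
  S-position v p = subst (T ∘ S) (sym (lookup-position v p)) p

  S-vertex : ∀ y q → T (S (χ (vertex y q)))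
  S-vertex y q = subst (T ∘ S) (sym (χ-vertex y q)) q

  position-injective : ∀ {u v} p q → position u p ≡ position v q → u ≡ v
  position-injective {u} {v} p q eq = begin
    u                                      ≡⟨ sym (vertex-position u p (S-position u p)) ⟩
    vertex (position u p) (S-position u p) ≡⟨ vertex-cong _ _ eq ⟩
    vertex (position v q) (S-position v q) ≡⟨ vertex-position v q (S-position v q) ⟩
    v                                      ∎
    where open ≡-Reasoning

module SubPlacement {V : Set} {k} (χ : V → Fin k) (w : List (Fin k)) (S : Fin k → Bool)
  (D′ : Fin k → Fin k → Bool) {E′ : Σ V (T ∘ S ∘ χ) → Σ V (T ∘ S ∘ χ) → Bool}
  (s : Solution E′ (χ ∘ proj₁) (filterᵇ S w) D′) where
  open FilterPositions S
  open Inverse (proj₁ s) renaming (to to f→; from to f←)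

  private
    lookup-f = proj₁ (proj₂ s)
    adj-f = proj₂ (proj₂ s)

  placement : Placement χ w S
  placement = record
    { position = position ; vertex = vertex ; lookup-position = lookup-position ; χ-vertex = χ-vertex
    ; position-vertex = position-vertex ; vertex-position = vertex-position }
    where
    open ≡-Reasoning

    position : ∀ v → T (S (χ v)) → Fin (length w)
    position v p = inject w (f→ (v , p))

    vertex : ∀ y → T (S (lookup w y)) → V
    vertex y q = proj₁ (f← (project w y q))

    lookup-position : ∀ v p → lookup w (position v p) ≡ χ v
    lookup-position v p = trans (lookup-inject w _) (lookup-f (v , p))

    χ-vertex : ∀ y q → χ (vertex y q) ≡ lookup w y
    χ-vertex y q = begin
      χ (vertex y q)                                 ≡⟨ sym (lookup-f _) ⟩
      lookup (filterᵇ S w) (f→ (f← (project w y q)))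
        ≡⟨ cong (lookup (filterᵇ S w)) (strictlyInverseˡ _) ⟩
      lookup (filterᵇ S w) (project w y q)           ≡⟨ lookup-project w y q ⟩
      lookup w y                                     ∎

    position-vertex : ∀ y q p → position (vertex y q) p ≡ y
    position-vertex y q p = begin
      inject w (f→ (vertex y q , p))     ≡⟨ cong (inject w ∘ f→) (Σ-T-≡ refl) ⟩
      inject w (f→ (f← (project w y q))) ≡⟨ cong (inject w) (strictlyInverseˡ _) ⟩
      inject w (project w y q)           ≡⟨ inject-project w y q ⟩
      y                                  ∎

    vertex-position : ∀ v p q → vertex (position v p) q ≡ v
    vertex-position v p q = begin
      proj₁ (f← (project w (inject w (f→ (v , p))) q)) ≡⟨ cong (proj₁ ∘ f←) (project-inject w _ q) ⟩
      proj₁ (f← (f→ (v , p)))                          ≡⟨ cong proj₁ (strictlyInverseʳ (v , p)) ⟩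
      v                                                ∎

  placement-adj : ∀ u v p q → E′ (u , p) (v , q) ≡
    letterAdj D′ w (Placement.position placement u p) (Placement.position placement v q)
  placement-adj u v p q = trans (adj-f (u , p) (v , q)) (letterAdj-filter D′ S w _ _)

module _ {V : Set} {k} {χ : V → Fin k} {w : List (Fin k)} {S : Fin k → Bool} (π : Placement χ w S)
         {E′ : Σ V (T ∘ S ∘ χ) → Σ V (T ∘ S ∘ χ) → Bool} {D′ : Fin k → Fin k → Bool}
         (adj : ∀ u v p q → E′ (u , p) (v , q) ≡
                  letterAdj D′ w (Placement.position π u p) (Placement.position π v q)) where
  open FilterPositions S
  open Placement π

  subsolution : Solution E′ (χ ∘ proj₁) (filterᵇ S w) D′
  subsolution = mk↔ₛ′ f→ f← f→f← f←f→ , lookup-f→ , adj-f→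
    where
    f→ : Σ V (T ∘ S ∘ χ) → Fin (length (filterᵇ S w))
    f→ (v , p) = project w (position v p) (S-position v p)

    f← : Fin (length (filterᵇ S w)) → Σ V (T ∘ S ∘ χ)
    f← i = vertex (inject w i) (P-inject w i) , S-vertex _ _

    inject-f→ : ∀ s → inject w (f→ s) ≡ position (proj₁ s) (proj₂ s)
    inject-f→ (v , p) = inject-project w _ _

    f→f← : ∀ i → f→ (f← i) ≡ i
    f→f← i = inject-injective w (trans (inject-f→ (f← i)) (position-vertex _ _ _))

    f←f→ : ∀ s → f← (f→ s) ≡ s
    f←f→ (v , p) =
      Σ-T-≡ (trans (vertex-cong _ (S-position v p) (inject-f→ (v , p))) (vertex-position v p _))

    lookup-f→ : ∀ s → lookup (filterᵇ S w) (f→ s) ≡ χ (proj₁ s)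
    lookup-f→ (v , p) =
      trans (sym (lookup-inject w _)) (trans (cong (lookup w) (inject-f→ (v , p))) (lookup-position v p))

    adj-f→ : ∀ s t → E′ s t ≡ letterAdj D′ (filterᵇ S w) (f→ s) (f→ t)
    adj-f→ (u , p) (v , q) = trans (adj u v p q) (sym (trans (letterAdj-filter D′ S w _ _)
      (cong₂ (letterAdj D′ w) (inject-f→ (u , p)) (inject-f→ (v , q)))))

solution-placement : ∀ {V : Set} {k} {E : V → V → Bool} {χ : V → Fin k} {w D} →
  Solution E χ w D → (S : Fin k → Bool) → Placement χ w S
solution-placement {χ = χ} {w} (f , lookup-f , _) S = record
  { position        = λ v _ → f→ v
  ; vertex          = λ y _ → f← y
  ; lookup-position = λ v _ → lookup-f v
  ; χ-vertex        = λ y _ → trans (sym (lookup-f (f← y))) (cong (lookup w) (strictlyInverseˡ y))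
  ; position-vertex = λ y _ _ → strictlyInverseˡ y
  ; vertex-position = λ v _ _ → strictlyInverseʳ v
  }
  where open Inverse f renaming (to to f→; from to f←)

module Gluing {V : Set} {k} {χ : V → Fin k} {w : List (Fin k)}
              (S : Fin k → Fin k → Bool) (S-refl : ∀ c → T (S c c))
              (π : ∀ c → Placement χ w (S c)) where
  open Placement

  glue : V → Fin (length w)
  glue v = position (π (χ v)) v (S-refl (χ v))

  unglue : Fin (length w) → V
  unglue y = vertex (π (lookup w y)) y (S-refl (lookup w y))

  glue-position : ∀ {c} v p → χ v ≡ c → glue v ≡ position (π c) v p
  glue-position v p refl = position-cong (π _) _ p refl

  unglue-vertex : ∀ {c} y q → lookup w y ≡ c → unglue y ≡ vertex (π c) y q
  unglue-vertex y q refl = vertex-cong (π _) _ q refl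

  lookup-glue : ∀ v → lookup w (glue v) ≡ χ v
  lookup-glue v = lookup-position (π (χ v)) v _

  glue-unglue : ∀ y → glue (unglue y) ≡ y
  glue-unglue y =
    trans (glue-position _ (S-vertex (π c) y _) (χ-vertex (π c) y _)) (position-vertex (π c) y _ _)
    where c = lookup w y

  unglue-glue : ∀ v → unglue (glue v) ≡ v
  unglue-glue v =
    trans (unglue-vertex _ (S-position (π c) v _) (lookup-glue v)) (vertex-position (π c) v _ _)
    where c = χ v

  glue-↔ : V ↔ Fin (length w)
  glue-↔ = mk↔ₛ′ glue unglue glue-unglue unglue-glue

  glue-injective : ∀ {u v} → glue u ≡ glue v → u ≡ v
  glue-injective {u} {v} eq = trans (sym (unglue-glue u)) (trans (cong unglue eq) (unglue-glue v))

module _ {n k} {χ : Fin n → Fin k} {w : List (Fin k)} {S : Fin k → Bool} (π : Placement χ w S) where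
  open Placement π

  placement-count : ∀ {b} → T (S b) → (R : Fin n → Bool) (R′ : Fin (length w) → Bool) →
    (∀ v p → χ v ≡ b → R v ≡ R′ (position v p)) →
    count (λ v → eqᵇ (χ v) b ∧ R v) ≡ count (λ y → eqᵇ (lookup w y) b ∧ R′ y)
  placement-count {b} Sb R R′ R≡R′ = count-cong (mk↔ₛ′ f→ f← f→f← f←f→)
    where
    S-of : ∀ {c} → c ≡ b → T (S c)
    S-of refl = Sb

    Vᵇ = Σ (Fin n) (λ v → T (eqᵇ (χ v) b ∧ R v))
    Wᵇ = Σ (Fin (length w)) (λ y → T (eqᵇ (lookup w y) b ∧ R′ y))

    f→ : Vᵇ → Wᵇ
    f→ (v , t) = position v (S-of cv) ,
                 from T-∧ (≡⇒T-eqᵇ (trans (lookup-position v _) cv) , subst T (R≡R′ v _ cv) (proj₂ t′))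
      where
      t′ = to T-∧ t
      cv = T-eqᵇ⇒≡ (proj₁ t′)

    f← : Wᵇ → Vᵇ
    f← (y , t) = vertex y (S-of cy) ,
                 from T-∧ (≡⇒T-eqᵇ cv , subst T (sym R≡R′-vertex) (proj₂ t′))
      where
      t′ = to T-∧ t
      cy = T-eqᵇ⇒≡ (proj₁ t′)
      cv = trans (χ-vertex y _) cy
      R≡R′-vertex = trans (R≡R′ _ (S-vertex y _) cv) (cong R′ (position-vertex y _ _))

    f→f← : ∀ s → f→ (f← s) ≡ s
    f→f← (y , t) = Σ-T-≡ (position-vertex y _ _)

    f←f→ : ∀ s → f← (f→ s) ≡ s
    f←f→ (v , t) = Σ-T-≡ (vertex-position v _ _)

module RestrictedPlacement {V : Set} {k} (χ : V → Fin k) (w : List (Fin k)) (S : Fin k → Bool)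
  (D cond : Fin k → Fin k → Bool) (cond-sym : ∀ c d → cond c d ≡ cond d c)
  {E′ : Σ V (T ∘ S ∘ χ) → Σ V (T ∘ S ∘ χ) → Bool}
  (s : Solution E′ (χ ∘ proj₁) (sub S w) (λ c d → D c d ∧ cond c d)) where
  open SubPlacement χ w S (λ c d → D c d ∧ cond c d) s public
  open Placement placement

  placement-adj-∧ : ∀ u v p q → T (cond (χ u) (χ v)) →
                    E′ (u , p) (v , q) ≡ letterAdj D w (position u p) (position v q)
  placement-adj-∧ u v p q t = begin
    E′ (u , p) (v , q)                         ≡⟨ placement-adj u v p q ⟩
    letterAdj (λ c d → D c d ∧ cond c d) w x y ≡⟨ letterAdj-∧ D w cond cond-sym x y ⟩
    letterAdj D w x y ∧ cond (lookup w x) (lookup w y)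
      ≡⟨ cong₂ (λ c d → letterAdj D w x y ∧ cond c d) (lookup-position u p) (lookup-position v q) ⟩
    letterAdj D w x y ∧ cond (χ u) (χ v)       ≡⟨ cong (letterAdj D w x y ∧_) (to T-≡ t) ⟩
    letterAdj D w x y ∧ true                   ≡⟨ ∧-identityʳ _ ⟩
    letterAdj D w x y                          ∎
    where
    open ≡-Reasoning
    x = position u p
    y = position v q

-- Solutions and the three conditions

between : ∀ {k} → (Fin k → Bool) → (Fin k → Bool) → Fin k → Fin k → Bool
between P Q c d = (P c ∧ Q d) ∨ (Q c ∧ P d)

between-sym : ∀ {k} (P Q : Fin k → Bool) c d → between P Q c d ≡ between P Q d c
between-sym P Q c d =
  trans (∨-comm (P c ∧ Q d) (Q c ∧ P d)) (cong₂ _∨_ (∧-comm (Q c) (P d)) (∧-comm (P c) (Q d)))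

module _ {V : Set} {k} {E : V → V → Bool} {χ : V → Fin k} (w : List (Fin k)) (D : Fin k → Fin k → Bool)
         (sol : Solution E χ w D) where
  open Inverse (proj₁ sol) using () renaming (to to f)

  private
    lookup-f = proj₁ (proj₂ sol)
    adj-f = proj₂ (proj₂ sol)

  restrict : (S : Fin k → Bool) (cond : Fin k → Fin k → Bool) → (∀ c d → cond c d ≡ cond d c) →
    {E′ : V → V → Bool} →
    (∀ u v → T (S (χ u)) → T (S (χ v)) → E′ u v ≡ E u v ∧ cond (χ u) (χ v)) →
    Solution {V = Σ V (T ∘ S ∘ χ)} (λ u v → E′ (proj₁ u) (proj₁ v)) (χ ∘ proj₁) (sub S w)
             (λ c d → D c d ∧ cond c d)
  restrict S cond cond-sym {E′} E′-restricts =
    subsolution (solution-placement {E = E} {χ} {w} {D} sol S) {D′ = λ c d → D c d ∧ cond c d} adj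
    where
    open ≡-Reasoning
    adj : ∀ u v (p : T (S (χ u))) (q : T (S (χ v))) →
          E′ u v ≡ letterAdj (λ c d → D c d ∧ cond c d) w (f u) (f v)
    adj u v p q = begin
      E′ u v
        ≡⟨ E′-restricts u v p q ⟩
      E u v ∧ cond (χ u) (χ v)
        ≡⟨ cong₂ _∧_ (adj-f u v) (sym (cong₂ cond (lookup-f u) (lookup-f v))) ⟩
      letterAdj D w (f u) (f v) ∧ cond (lookup w (f u)) (lookup w (f v))
        ≡⟨ sym (letterAdj-∧ D w cond cond-sym (f u) (f v)) ⟩
      letterAdj (λ c d → D c d ∧ cond c d) w (f u) (f v) ∎

solution⇒conditions : ∀ {n k} (E : Fin n → Fin n → Bool) (χ : Fin n → Fin k) w D →
  Solution E χ w D → Cond1 E χ w D × Cond2 E χ w D × Cond3 E χ w D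
solution⇒conditions E χ w D sol =
    (λ a → restrict w D sol (λ c → eqᵇ c a) (λ c d → eqᵇ c a ∧ eqᵇ d a)
             (λ c d → ∧-comm (eqᵇ c a) (eqᵇ d a)) (E-within a))
  , (λ a b _ _ → restrict w D sol (pairL a b) (between (λ c → eqᵇ c a) (λ c → eqᵇ c b))
                   (between-sym (λ c → eqᵇ c a) (λ c → eqᵇ c b)) (λ _ _ _ _ → refl))
  , (λ a → restrict w D sol (λ c → eqᵇ c a ∨ inP E χ w a c) (between (λ c → eqᵇ c a) (inP E χ w a))
             (between-sym (λ c → eqᵇ c a) (inP E χ w a)) (λ _ _ _ _ → refl))
  where
  E-within : ∀ a u v → T (eqᵇ (χ u) a) → T (eqᵇ (χ v) a) →
             E u v ≡ E u v ∧ (eqᵇ (χ u) a ∧ eqᵇ (χ v) a)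
  E-within a u v p q rewrite to T-≡ p | to T-≡ q = sym (∧-identityʳ (E u v))

module FromConditions {n k} (E : Fin n → Fin n → Bool) (χ : Fin n → Fin k) (w : List (Fin k))
  (D : Fin k → Fin k → Bool) (E-sym : ∀ u v → E u v ≡ E v u)
  (one-sided-runs : ∀ (a b : Fin k) → T (not (eqᵇ a b)) → T (oneSided E χ a b) →
                    (2 ≤ runs a (sub (pairL a b) w)) ⊎ (2 ≤ runs b (sub (pairL a b) w)))
  (cond1 : Cond1 E χ w D) (cond2 : Cond2 E χ w D) (cond3 : Cond3 E χ w D) where

  open OneSided E χ
  open Placement
  open ≡-Reasoning

  cond₁ : Fin k → Fin k → Fin k → Bool
  cond₁ a c d = eqᵇ c a ∧ eqᵇ d a

  module P₁ (a : Fin k) = RestrictedPlacement χ w (λ c → eqᵇ c a) D (cond₁ a)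
    (λ c d → ∧-comm (eqᵇ c a) (eqᵇ d a)) (cond1 a)

  cond₂ : Fin k → Fin k → Fin k → Fin k → Bool
  cond₂ a b = between (λ c → eqᵇ c a) (λ c → eqᵇ c b)

  module P₂ {a b : Fin k} (a≢b : a ≢ b) (¬os : ¬ T (oneSided E χ a b)) =
    RestrictedPlacement χ w (pairL a b) D (cond₂ a b) (between-sym (λ c → eqᵇ c a) (λ c → eqᵇ c b))
      (cond2 a b (¬T⇒T-not (a≢b ∘ T-eqᵇ⇒≡)) (¬T⇒T-not ¬os))

  S : Fin k → Fin k → Bool
  S c d = eqᵇ d c ∨ inP E χ w c d

  S-refl : ∀ c → T (S c c)
  S-refl c = T-∨-introˡ (inP E χ w c c) (≡⇒T-eqᵇ {c = c} refl)

  cond₃ : Fin k → Fin k → Fin k → Bool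
  cond₃ a = between (λ c → eqᵇ c a) (inP E χ w a)

  module P₃ (a : Fin k) = RestrictedPlacement χ w (S a) D (cond₃ a)
    (between-sym (λ c → eqᵇ c a) (inP E χ w a)) (cond3 a)

  π : ∀ c → Placement χ w (S c)
  π = P₃.placement

  open Gluing S S-refl π

  inP-intro : ∀ {a b} → a ≢ b → T (oneSided E χ a b) → 2 ≤ runs a (sub (pairL a b) w) →
              T (inP E χ w a b)
  inP-intro a≢b os two-runs =
    T-∧-intro (¬T⇒T-not (a≢b ∘ sym ∘ T-eqᵇ⇒≡)) (T-∧-intro os (<⇒<ᵇ two-runs))

  inP-elim : ∀ a b → T (inP E χ w a b) → a ≢ b × T (oneSided E χ a b)
  inP-elim a b t =
    (λ a≡b → T-not⇒¬T (proj₁ b≢a,rest) (≡⇒T-eqᵇ (sym a≡b))) ,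
    proj₁ (to (T-∧ {x = oneSided E χ a b}) (proj₂ b≢a,rest))
    where b≢a,rest = to (T-∧ {x = not (eqᵇ b a)}) t

  edge-π : ∀ {a} u v p q → T (cond₃ a (χ u) (χ v)) →
           E u v ≡ letterAdj D w (position (π a) u p) (position (π a) v q)
  edge-π {a} u v p q t = trans (sym (∧-T-identityʳ (E u v) t)) (P₃.placement-adj-∧ a u v p q t)

  adj-same-colour : ∀ u v → χ u ≡ χ v → E u v ≡ letterAdj D w (glue u) (glue v)
  adj-same-colour u v cu≡cv = begin
    E u v                           ≡⟨ P₁.placement-adj-∧ (χ u) u v pu pv (T-∧-intro pu pv) ⟩
    letterAdj D w (σ u pu) (σ v pv) ≡⟨ letterAdj-same-letter-≡ D w σu≡σv⇒glue (glue⇒σu≡σv)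
                                         (lookup-position σ-π u pu) (σ-lookup v pv cu≡cv)
                                         (lookup-glue u) (trans (lookup-glue v) (sym cu≡cv)) ⟩
    letterAdj D w (glue u) (glue v) ∎
    where
    σ-π = P₁.placement (χ u)
    σ = position σ-π
    σ-lookup : ∀ v p → χ u ≡ χ v → lookup w (σ v p) ≡ χ u
    σ-lookup v p cu≡cv = trans (lookup-position σ-π v p) (sym cu≡cv)
    pu = ≡⇒T-eqᵇ {c = χ u} refl
    pv = ≡⇒T-eqᵇ (sym cu≡cv)
    σu≡σv⇒glue : σ u pu ≡ σ v pv → glue u ≡ glue v
    σu≡σv⇒glue = cong glue ∘ position-injective σ-π pu pv
    glue⇒σu≡σv : glue u ≡ glue v → σ u pu ≡ σ v pv
    glue⇒σu≡σv = position-cong σ-π pu pv ∘ glue-injective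

  -- E is constant on V_a × V_b, so the pair that condition (2) places at glue u and glue v decides.
  adj-not-one-sided : ∀ u v → χ u ≢ χ v → ¬ T (oneSided E χ (χ u) (χ v)) →
                      E u v ≡ letterAdj D w (glue u) (glue v)
  adj-not-one-sided u v a≢b ¬os = begin
    E u v
      ≡⟨ ¬oneSided⇒constant ¬os refl refl cu′ cv′ ⟩
    E u′ v′
      ≡⟨ sym (∧-T-identityʳ (E u′ v′) cond-u′v′) ⟩
    E u′ v′ ∧ cond₂ (χ u) (χ v) (χ u′) (χ v′)
      ≡⟨ P₂.placement-adj-∧ a≢b ¬os u′ v′ pu′ pv′ cond-u′v′ ⟩
    letterAdj D w (position τ u′ pu′) (position τ v′ pv′)
      ≡⟨ cong₂ (letterAdj D w) (position-vertex τ (glue u) qu _) (position-vertex τ (glue v) qv _) ⟩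
    letterAdj D w (glue u) (glue v) ∎
    where
    τ = P₂.placement a≢b ¬os
    qu = T-∨-introˡ _ (≡⇒T-eqᵇ (lookup-glue u))
    qv = T-∨-introʳ (eqᵇ (lookup w (glue v)) (χ u)) (≡⇒T-eqᵇ (lookup-glue v))
    u′ = vertex τ (glue u) qu
    v′ = vertex τ (glue v) qv
    pu′ = S-vertex τ (glue u) qu
    pv′ = S-vertex τ (glue v) qv
    cu′ = trans (χ-vertex τ (glue u) qu) (lookup-glue u)
    cv′ = trans (χ-vertex τ (glue v) qv) (lookup-glue v)
    cond-u′v′ : T (cond₂ (χ u) (χ v) (χ u′) (χ v′))
    cond-u′v′ = T-∨-introˡ _ (T-∧-intro (≡⇒T-eqᵇ cu′) (≡⇒T-eqᵇ cv′))

  module OneSidedPair (u v : Fin n) (b∈Pa : T (inP E χ w (χ u) (χ v))) where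
    a = χ u
    b = χ v

    a≢b : a ≢ b
    a≢b = proj₁ (inP-elim a b b∈Pa)

    pva : T (S a b)
    pva = T-∨-introʳ (eqᵇ b a) b∈Pa

    edge-a : ∀ v′ p → χ v′ ≡ b → E u v′ ≡ letterAdj D w (glue u) (position (π a) v′ p)
    edge-a v′ p cv′ = edge-π u v′ (S-refl a) p
      (T-∨-introˡ _ (T-∧-intro (≡⇒T-eqᵇ {c = a} refl) (subst (T ∘ inP E χ w a) (sym cv′) b∈Pa)))

    -- Conditions (3) at a and at b place u at a-positions whose b-neighbourhoods both correspond
    -- to the neighbours of u in V_b.
    via-counting : T (inP E χ w b a) → E u v ≡ letterAdj D w (glue u) (glue v)
    via-counting a∈Pb = begin
      E u v                           ≡⟨ edge-b v (S-refl b) refl ⟩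
      letterAdj D w x′ (glue v)       ≡⟨ sym (letterAdj-count-≡ D w a≢b (lookup-glue u) (lookup-position (π b) u pub)
                                                same-count (glue v) (lookup-glue v)) ⟩
      letterAdj D w (glue u) (glue v) ∎
      where
      pub : T (S b a)
      pub = T-∨-introʳ (eqᵇ a b) a∈Pb
      x′ = position (π b) u pub
      edge-b : ∀ v′ p → χ v′ ≡ b → E u v′ ≡ letterAdj D w x′ (position (π b) v′ p)
      edge-b v′ p cv′ = begin
        E u v′                                    ≡⟨ E-sym u v′ ⟩
        E v′ u                                    ≡⟨ edge-π v′ u p pub (T-∨-introˡ _ (T-∧-intro (≡⇒T-eqᵇ cv′) a∈Pb)) ⟩
        letterAdj D w (position (π b) v′ p) x′    ≡⟨ letterAdj-sym D w (position (π b) v′ p) x′ ⟩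
        letterAdj D w x′ (position (π b) v′ p)    ∎
      same-count : count (λ y → eqᵇ (lookup w y) b ∧ letterAdj D w (glue u) y) ≡
                   count (λ y → eqᵇ (lookup w y) b ∧ letterAdj D w x′ y)
      same-count = trans (sym (placement-count (π a) pva (E u) (letterAdj D w (glue u)) edge-a))
                         (placement-count (π b) (S-refl b) (E u) (letterAdj D w x′) edge-b)

    -- w[b,a] has a single b-run, so no a-position lies strictly between two b-positions.
    via-single-run : ¬ T (inP E χ w b a) → E u v ≡ letterAdj D w (glue u) (glue v)
    via-single-run a∉Pb = begin
      E u v                                         ≡⟨ edge-a v pva refl ⟩
      letterAdj D w (glue u) (position (π a) v pva) ≡⟨ letterAdj-same-side D w a≢b (lookup-glue u) wy (lookup-glue v)
                                                         (no-a-between wy (lookup-glue v))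
                                                         (no-a-between (lookup-glue v) wy) ⟩
      letterAdj D w (glue u) (glue v)               ∎
      where
      wy = lookup-position (π a) v pva
      no-a-between : ∀ {y y′} → lookup w y ≡ b → lookup w y′ ≡ b →
                     ¬ (toℕ y < toℕ (glue u) × toℕ (glue u) < toℕ y′)
      no-a-between wy wy′ (y<x , x<y′) =
        a∉Pb (inP-intro (a≢b ∘ sym) (oneSided-sym E-sym (proj₂ (inP-elim a b b∈Pa)))
                        (runs-pairL-≥2 w a≢b y<x x<y′ wy (lookup-glue u) wy′))

  adj-in-P : ∀ u v → T (inP E χ w (χ u) (χ v)) → E u v ≡ letterAdj D w (glue u) (glue v)
  adj-in-P u v b∈Pa = [ via-counting , via-single-run ]′ (toSum (T? (inP E χ w (χ v) (χ u))))
    where open OneSidedPair u v b∈Pa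

  adj : ∀ u v → E u v ≡ letterAdj D w (glue u) (glue v)
  adj u v = by-cases (χ u ≟ χ v) (T? (oneSided E χ (χ u) (χ v)))
    where
    by-cases : Dec (χ u ≡ χ v) → Dec (T (oneSided E χ (χ u) (χ v))) →
               E u v ≡ letterAdj D w (glue u) (glue v)
    by-cases (yes a≡b) _         = adj-same-colour u v a≡b
    by-cases (no  a≢b) (no  ¬os) = adj-not-one-sided u v a≢b ¬os
    by-cases (no  a≢b) (yes os)  =
      [ b-in-Pa , a-in-Pb ]′ (one-sided-runs (χ u) (χ v) (¬T⇒T-not (a≢b ∘ T-eqᵇ⇒≡)) os)
      where
      b-in-Pa : 2 ≤ runs (χ u) (sub (pairL (χ u) (χ v)) w) → E u v ≡ letterAdj D w (glue u) (glue v)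
      b-in-Pa a-runs = adj-in-P u v (inP-intro a≢b os a-runs)

      a-in-Pb : 2 ≤ runs (χ v) (sub (pairL (χ u) (χ v)) w) → E u v ≡ letterAdj D w (glue u) (glue v)
      a-in-Pb b-runs = begin
        E u v                           ≡⟨ E-sym u v ⟩
        E v u                           ≡⟨ adj-in-P v u (inP-intro (a≢b ∘ sym) (oneSided-sym E-sym os) b-runs′) ⟩
        letterAdj D w (glue v) (glue u) ≡⟨ letterAdj-sym D w (glue v) (glue u) ⟩
        letterAdj D w (glue u) (glue v) ∎
        where b-runs′ = subst (λ z → 2 ≤ runs (χ v) z) (sub-pairL-comm (χ u) (χ v) w) b-runs

  solution : Solution E χ w D
  solution = glue-↔ , lookup-glue , adj

lemma7 : ∀ {n k} (E : Fin n → Fin n → Bool) (χ : Fin n → Fin k) (w : List (Fin k)) →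
           IsInstance E χ w →
           (D : Fin k → Fin k → Bool) →
           (∀ (a b : Fin k) → T (not (eqᵇ a b)) → T (oneSided E χ a b) →
             (2 ≤ runs a (sub (pairL a b) w)) ⊎ (2 ≤ runs b (sub (pairL a b) w))) →
           Solution E χ w D ⇔ (Cond1 E χ w D × Cond2 E χ w D × Cond3 E χ w D)
lemma7 E χ w (E-sym , _) D one-sided-runs =
  mk⇔ (solution⇒conditions E χ w D)
      (λ (cond1 , cond2 , cond3) →
         FromConditions.solution E χ w D E-sym one-sided-runs cond1 cond2 cond3)
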